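{- Let $n\ge 3$. Then $\mathrm{SG}(n^3)=\mathrm{SG}(3^n)=0$ if $n$ is odd and $=1$ if $n$ is even.
   Context: $(a^k)$ denotes the partition with $k$ parts equal to $a$. LCTR: positions are partitions; from nonempty $\lambda=(\lambda_1,\dots,\lambda_k)$ one may move to $T(\lambda)=(\lambda_2,\dots,\lambda_k)$ or $L(\lambda)=(\lambda_1-1,\dots,\lambda_k-1)$ (nonpositive entries omitted); $()$ has no moves. $\mathrm{SG}(())=0$, $\mathrm{SG}(\lambda)=\mathrm{mex}\{\mathrm{SG}(L(\lambda)),\mathrm{SG}(T(\lambda))\}$ otherwise, with $\mathrm{mex}(B)$ the least nonnegative integer not in $B$. -}

module Defs where

open import Data.Nat using (ℕ; zero; suc; _+_; _∸_; _≟_)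
open import Data.List using (List; []; _∷_; length; replicate; map; filter)
open import Data.Nat.ListAction using (sum)
open import Data.Bool using (Bool; true; false; if_then_else_)
open import Relation.Nullary.Decidable using (does)
open import Data.Bool.ListAction using (any)
open import Relation.Nullary using (¬_)
open import Relation.Nullary.Decidable using (¬?)

-- A partition is a list of positive integers in nonincreasing order;
-- λ = (λ₁, …, λₖ) is represented as λ₁ ∷ … ∷ λₖ ∷ [].
Partition : Set
Partition = List ℕ

-- (a^k): the partition with k parts equal to a
rep : ℕ → ℕ → Partition
rep a k = replicate k a

T : Partition → Partition
T []       = []
T (_ ∷ xs) = xs

L : Partition → Partition
L xs = filter (λ x → ¬? (x ≟ 0)) (map (λ x → x ∸ 1) xs)

-- mex(B): least nonnegative integer not in the finite set B (given as a list).
-- Searching 0,1,…,|B| suffices since some value ≤ |B| is missing.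
_∈ᵇ_ : ℕ → List ℕ → Bool
m ∈ᵇ B = any (λ b → does (m ≟ b)) B

mexFrom : ℕ → ℕ → List ℕ → ℕ
mexFrom zero    m B = m
mexFrom (suc k) m B = if m ∈ᵇ B then mexFrom k (suc m) B else m

mex : List ℕ → ℕ
mex B = mexFrom (length B) 0 B

-- Sprague–Grundy value with a fuel argument (used for termination only).
-- Each move from a nonempty partition strictly decreases (sum + length),
-- so fuel = sum λ + length λ is always sufficient.
SGf : ℕ → Partition → ℕ
SGf _       []       = 0
SGf zero    (_ ∷ _)  = 0
SGf (suc f) (x ∷ xs) = mex (SGf f (L (x ∷ xs)) ∷ SGf f (T (x ∷ xs)) ∷ [])

SG : Partition → ℕ
SG xs = SGf (sum xs + length xs) xs

-- Both (n^3) and (3^n) are n × 3 rectangles up to transposition. From a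
-- rectangle a × k, L gives (a−1) × k and T gives a × (k−1), so the Grundy values
-- satisfy g(a,k) = mex{g(a−1,k), g(a,k−1)}, which is symmetric in a and k. The
-- columns k = 1, 2, 3 are then 2-periodic in a, with column 3 equal to 0 on odd
-- and 1 on even a ≥ 3.
module Submission where

open import Defs
open import Data.Nat using (ℕ; _≤_; _%_; zero; suc; _+_; s≤s)
open import Data.Nat.Properties using (+-suc; +-mono-≤; m≤m+n; ≤-reflexive; 0≢1+n)
open import Data.Nat.ListAction using (sum)
open import Data.Product using (_×_; _,_)
open import Data.List using (_∷_; []; length)
open import Data.List.Properties using (length-replicate)
open import Relation.Nullary using (contradiction)
open import Relation.Binary.PropositionalEquality using (_≡_; refl; sym; trans; cong; cong₂; subst)

mex₂ : ℕ → ℕ → ℕ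
mex₂ x y = mex (x ∷ y ∷ [])

mex₂-comm : ∀ x y → mex₂ x y ≡ mex₂ y x
mex₂-comm zero          zero          = refl
mex₂-comm zero          (suc zero)    = refl
mex₂-comm zero          (suc (suc y)) = refl
mex₂-comm (suc zero)    zero          = refl
mex₂-comm (suc zero)    (suc zero)    = refl
mex₂-comm (suc zero)    (suc (suc y)) = refl
mex₂-comm (suc (suc x)) zero          = refl
mex₂-comm (suc (suc x)) (suc zero)    = refl
mex₂-comm (suc (suc x)) (suc (suc y)) = refl

-- The a × k rectangle (a^k); unlike rep, it is empty when a = 0.
rectangle : ℕ → ℕ → Partition
rectangle zero    k = []
rectangle (suc a) k = rep (suc a) k

rectangleSG : ℕ → ℕ → ℕ
rectangleSG zero    k       = 0
rectangleSG (suc a) zero    = 0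
rectangleSG (suc a) (suc k) = mex₂ (rectangleSG a (suc k)) (rectangleSG (suc a) k)

L-rectangle : ∀ a k → L (rectangle (suc a) k) ≡ rectangle a k
L-rectangle zero    zero    = refl
L-rectangle (suc a) zero    = refl
L-rectangle zero    (suc k) = L-rectangle zero k
L-rectangle (suc a) (suc k) = cong (suc a ∷_) (L-rectangle (suc a) k)

SGf-rectangle : ∀ f a k → a + k ≤ f → SGf f (rectangle a k) ≡ rectangleSG a k
SGf-rectangle zero    zero    k       _ = refl
SGf-rectangle (suc f) zero    k       _ = refl
SGf-rectangle zero    (suc a) zero    _ = refl
SGf-rectangle (suc f) (suc a) zero    _ = refl
SGf-rectangle (suc f) (suc a) (suc k) (s≤s a+1+k≤f) = cong₂ mex₂
  (trans (cong (SGf f) (L-rectangle a (suc k))) (SGf-rectangle f a (suc k) a+1+k≤f))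
  (SGf-rectangle f (suc a) k (subst (_≤ f) (+-suc a k) a+1+k≤f))

SG-rectangle : ∀ a k → SG (rep (suc a) (suc k)) ≡ rectangleSG (suc a) (suc k)
SG-rectangle a k = SGf-rectangle _ (suc a) (suc k) enough-fuel
  where
  enough-fuel : suc a + suc k ≤ sum (rep (suc a) (suc k)) + length (rep (suc a) (suc k))
  enough-fuel = +-mono-≤ (m≤m+n (suc a) _) (s≤s (≤-reflexive (sym (length-replicate k))))

rectangleSG-transpose : ∀ a k → rectangleSG a k ≡ rectangleSG k a
rectangleSG-transpose zero    zero    = refl
rectangleSG-transpose zero    (suc k) = refl
rectangleSG-transpose (suc a) zero    = refl
rectangleSG-transpose (suc a) (suc k) = trans
  (cong₂ mex₂ (rectangleSG-transpose a (suc k)) (rectangleSG-transpose (suc a) k))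
  (mex₂-comm (rectangleSG (suc k) a) (rectangleSG k (suc a)))

SG-rectangle-and-transpose : ∀ a k {v} → rectangleSG (suc a) (suc k) ≡ v →
  SG (rep (suc a) (suc k)) ≡ v × SG (rep (suc k) (suc a)) ≡ v
SG-rectangle-and-transpose a k g≡v =
  trans (SG-rectangle a k) g≡v ,
  trans (SG-rectangle k a) (trans (rectangleSG-transpose (suc k) (suc a)) g≡v)

double : ℕ → ℕ
double zero    = 0
double (suc j) = suc (suc (double j))

data Parity : ℕ → Set where
  even : ∀ j → Parity (double j)
  odd  : ∀ j → Parity (suc (double j))

parity : ∀ n → Parity n
parity zero = even 0
parity (suc n) with parity n
... | even j = odd j
... | odd j  = even (suc j)

double-%2 : ∀ j → double j % 2 ≡ 0
double-%2 zero    = refl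
double-%2 (suc j) = double-%2 j

suc-double-%2 : ∀ j → suc (double j) % 2 ≡ 1
suc-double-%2 zero    = refl
suc-double-%2 (suc j) = suc-double-%2 j

rectangleSG-odd×1  : ∀ j → rectangleSG (1 + double j) 1 ≡ 1
rectangleSG-even×1 : ∀ j → rectangleSG (2 + double j) 1 ≡ 2
rectangleSG-odd×1 zero    = refl
rectangleSG-odd×1 (suc j) = cong (λ x → mex₂ x 0) (rectangleSG-even×1 j)
rectangleSG-even×1 j      = cong (λ x → mex₂ x 0) (rectangleSG-odd×1 j)

rectangleSG-odd×2  : ∀ j → rectangleSG (1 + double j) 2 ≡ 2
rectangleSG-even×2 : ∀ j → rectangleSG (2 + double j) 2 ≡ 0
rectangleSG-odd×2 zero    = refl
rectangleSG-odd×2 (suc j) = cong₂ mex₂ (rectangleSG-even×2 j) (rectangleSG-odd×1 (suc j))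
rectangleSG-even×2 j      = cong₂ mex₂ (rectangleSG-odd×2 j) (rectangleSG-even×1 j)

rectangleSG-odd×3  : ∀ j → rectangleSG (3 + double j) 3 ≡ 0
rectangleSG-even×3 : ∀ j → rectangleSG (4 + double j) 3 ≡ 1
rectangleSG-odd×3 zero    = refl
rectangleSG-odd×3 (suc j) = cong₂ mex₂ (rectangleSG-even×3 j) (rectangleSG-odd×2 (suc (suc j)))
rectangleSG-even×3 j      = cong₂ mex₂ (rectangleSG-odd×3 j) (rectangleSG-even×2 (suc j))

lemma3p6 : (n : ℕ) → 3 ≤ n →
    (n % 2 ≡ 1 → SG (rep n 3) ≡ 0 × SG (rep 3 n) ≡ 0) ×
    (n % 2 ≡ 0 → SG (rep n 3) ≡ 1 × SG (rep 3 n) ≡ 1)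
lemma3p6 n 3≤n with parity n
lemma3p6 _ () | even zero
lemma3p6 _ (s≤s (s≤s ())) | even (suc zero)
lemma3p6 _ _ | even (suc (suc i)) =
  (λ n-odd → contradiction (trans (sym (double-%2 i)) n-odd) 0≢1+n) ,
  λ _ → SG-rectangle-and-transpose (3 + double i) 2 (rectangleSG-even×3 i)
lemma3p6 _ (s≤s ()) | odd zero
lemma3p6 _ _ | odd (suc i) =
  (λ _ → SG-rectangle-and-transpose (2 + double i) 2 (rectangleSG-odd×3 i)) ,
  λ n-even → contradiction (trans (sym n-even) (suc-double-%2 i)) 0≢1+n
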